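{- Let $n\ge 3$ and let $F_n$ be a cycle on $n$ vertices. Then $F_n$ is potentially triangulable in the convex complete graph $K_n$ if and only if $n\ge 7$.
   Context: A convex complete graph $K_n$ is the complete graph on $n$ points in convex position in the plane, edges drawn as straight-line segments. For a subgraph $F$ of $K_n$, $K_n-F$ is obtained by deleting the edges of $F$ (all vertices kept). A convex graph on $n$ vertices admits a triangulation if it contains all $n$ boundary edges (edges between vertices consecutive along the convex hull boundary) and $n-3$ pairwise non-crossing diagonals. A graph $F$ with at most $n$ vertices is potentially triangulable in $K_n$ if there is an embedding of $F$ as a subgraph of $K_n$ (an injective placement of its vertices on the vertices of $K_n$, edges becoming the corresponding edges of $K_n$) such that $K_n-F$ admits a triangulation. -}

module Defs where

open import Data.Nat using (ℕ; zero; suc; _<_; _∸_)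
open import Data.Fin using (Fin; toℕ)
open import Data.Product using (Σ; ∃; _×_; _,_)
open import Data.Sum using (_⊎_)
open import Data.List using (List; length)
open import Data.List.Relation.Unary.All using (All)
open import Data.List.Relation.Unary.Unique.Propositional using (Unique)
open import Data.List.Relation.Unary.AllPairs using (AllPairs)
open import Relation.Nullary using (¬_)
open import Relation.Binary.PropositionalEquality using (_≡_)
open import Function.Definitions using (Injective)

-- Vertices of the convex K_n are Fin n, listed in cyclic order along the hull.
-- Consec n a b : b is the cyclic successor of a among 0 … n-1.
Consec : ℕ → ℕ → ℕ → Set
Consec n a b = (suc a ≡ b) ⊎ ((suc a ≡ n) × (b ≡ 0))

Boundary : (n : ℕ) → Fin n → Fin n → Set
Boundary n u v = Consec n (toℕ u) (toℕ v) ⊎ Consec n (toℕ v) (toℕ u)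

-- Two chords {a,b}, {c,d} with a<b, c<d cross iff their endpoints interleave.
Cross : {n : ℕ} → Fin n × Fin n → Fin n × Fin n → Set
Cross (a , b) (c , d) =
  (toℕ a < toℕ c × toℕ c < toℕ b × toℕ b < toℕ d) ⊎
  (toℕ c < toℕ a × toℕ a < toℕ d × toℕ d < toℕ b)

-- A convex graph on Fin n, given by its (symmetric) edge relation G,
-- admits a triangulation: it contains all n boundary edges and n-3
-- distinct, pairwise non-crossing diagonals (diagonal {a,b} stored with a<b).
AdmitsTriangulation : (n : ℕ) → (Fin n → Fin n → Set) → Set
AdmitsTriangulation n G =
  (∀ u v → Boundary n u v → G u v) ×
  Σ (List (Fin n × Fin n)) λ ds →
      (length ds ≡ n ∸ 3)
    × Unique ds
    × All (λ { (a , b) → (toℕ a < toℕ b) × ¬ Boundary n a b × G a b }) ds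
    × AllPairs (λ e e' → ¬ Cross e e') ds

-- The cycle C_n on vertex set Fin n (edges {k, k+1 mod n}), placed in K_n by
-- f : Fin n → Fin n; CycleEdge n f u v : {u,v} is the image of a cycle edge.
CycleEdge : (n : ℕ) → (Fin n → Fin n) → Fin n → Fin n → Set
CycleEdge n f u v =
  Σ (Fin n) λ k → Σ (Fin n) λ l → Consec n (toℕ k) (toℕ l) ×
    (((f k ≡ u) × (f l ≡ v)) ⊎ ((f k ≡ v) × (f l ≡ u)))

KnMinusCycle : (n : ℕ) → (Fin n → Fin n) → Fin n → Fin n → Set
KnMinusCycle n f u v = ¬ (u ≡ v) × ¬ CycleEdge n f u v

CyclePotentiallyTriangulable : ℕ → Set
CyclePotentiallyTriangulable n =
  Σ (Fin n → Fin n) λ f → Injective _≡_ _≡_ f × AdmitsTriangulation n (KnMinusCycle n f)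

-- Boundary edges of the hull lie in K_n − C_n, so every edge of the embedded cycle is a
-- chord, and at each vertex two of its n − 3 chords are taken by the cycle.  For n = 3, 4 this
-- is already impossible; for n = 5 no vertex is left with a diagonal of the triangulation,
-- which has two; for n = 6 the three diagonals would have pairwise disjoint endpoints, and no
-- three such diagonals of a hexagon avoid crossing.  For n ≥ 7 triangulate by the diagonals
-- 13, 14 and the fan 0j (4 ≤ j ≤ n − 2), and embed the cycle as the tour
-- 1, 2⌊n/2⌋ − 1, …, 5, 3, 0, 2, 4, …, 2⌈n/2⌉ − 2: its edges are the skips {x, x + 2}
-- (x ≠ 1), {0, 3} and two edges from 1 to vertices ≥ 5, none of which is a boundary edge or a
-- diagonal of the triangulation.

module Submission where

open import Defs
open import Data.Nat as ℕ using (ℕ; zero; suc; _+_; _*_; _∸_; _≤_; _<_; z≤n; s≤s; ⌊_/2⌋; ⌈_/2⌉)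
import Data.Nat.Properties as ℕ
open import Data.Fin using (Fin; zero; suc; toℕ; fromℕ; fromℕ<; inject₁; lower₁; punchOut; _↑ʳ_)
open import Data.Fin.Patterns using (0F; 1F; 3F; 4F)
open import Data.Fin.Properties
  using (toℕ<n; all?; any?; _≟_; toℕ-fromℕ; toℕ-fromℕ<; toℕ-inject₁; toℕ-lower₁; toℕ-↑ʳ;
         ↑ʳ-injective; inject₁-injective; punchOut-injective; injective⇒≤)
open import Data.Product using (Σ; ∃; ∃₂; _×_; _,_; proj₁; proj₂)
open import Data.Sum using (_⊎_; inj₁; inj₂; [_,_]′)
open import Data.Empty using (⊥; ⊥-elim)
open import Data.Maybe using (just)
open import Data.Maybe.Relation.Binary.Connected as Connected using (Connected; just)
open import Data.List using (List; []; _∷_; _++_; length; lookup; head; last; tabulate; applyUpTo; applyDownFrom)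
open import Data.List.Properties
  using (length-++; length-applyUpTo; length-applyDownFrom; length-tabulate; applyUpTo-∷ʳ; applyDownFrom-∷ʳ)
open import Data.List.Membership.Propositional using (_∈_)
open import Data.List.Membership.Propositional.Properties using (∈-lookup; ∈-applyUpTo⁻)
open import Data.List.Relation.Unary.All as All using (All; []; _∷_)
import Data.List.Relation.Unary.All.Properties as Allₚ
open import Data.List.Relation.Unary.AllPairs using (AllPairs; []; _∷_)
import Data.List.Relation.Unary.AllPairs.Properties as AllPairsₚ
open import Data.List.Relation.Unary.Linked using (Linked; []; [-]; _∷_)
import Data.List.Relation.Unary.Linked.Properties as Linkedₚ
open import Data.List.Relation.Unary.Unique.Propositional using (Unique)
import Data.List.Relation.Unary.Unique.Propositional.Properties as Uniqueₚ
open import Data.Nat.Tactic.RingSolver using (solve-∀)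
open import Function using (_∘_)
open import Function.Definitions using (Injective)
open import Relation.Binary.Construct.Closure.Symmetric using (SymClosure; fwd; bwd)
import Relation.Binary.Construct.Closure.Symmetric as SymClosure
open import Relation.Binary.Definitions using (Symmetric)
open import Relation.Binary.PropositionalEquality using (_≡_; _≢_; refl; sym; trans; cong; cong₂; subst; subst₂)
open import Relation.Nullary using (¬_; Dec; yes; no; contradiction)
open import Relation.Nullary.Decidable using (from-yes; ¬?; _×-dec_; _⊎-dec_; _→-dec_)

Consec-irrefl : ∀ {n x} → Consec n x x → n ≡ 1
Consec-irrefl (inj₁ 1+x≡x)        = ⊥-elim (ℕ.1+n≢n 1+x≡x)
Consec-irrefl (inj₂ (refl , refl)) = refl

Consec-asym : ∀ {n x y} → Consec n x y → Consec n y x → n ≤ 2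
Consec-asym (inj₁ refl)          (inj₁ 2+x≡x)        = ⊥-elim (ℕ.m≢1+n+m _ {1} (sym 2+x≡x))
Consec-asym (inj₁ refl)          (inj₂ (refl , refl)) = ℕ.≤-refl
Consec-asym (inj₂ (refl , refl)) (inj₁ refl)          = ℕ.≤-refl
Consec-asym (inj₂ (refl , refl)) (inj₂ (_ , refl))    = s≤s z≤n

Boundary-irrefl : ∀ {n} {u : Fin n} → 2 ≤ n → ¬ Boundary n u u
Boundary-irrefl 2≤n b with refl ← [ Consec-irrefl , Consec-irrefl ]′ b = ℕ.1+n≰n 2≤n

Boundary-sym : ∀ {n} {u v : Fin n} → Boundary n u v → Boundary n v u
Boundary-sym = [ inj₂ , inj₁ ]′

successor : ∀ {n} (k : Fin n) → Σ (Fin n) λ l → Consec n (toℕ k) (toℕ l)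
successor {suc m} k with toℕ k ℕ.≟ m
... | yes k≡m = zero , inj₂ (cong suc k≡m , refl)
... | no  k≢m = suc (lower₁ k (k≢m ∘ sym)) , inj₁ (cong suc (sym (toℕ-lower₁ k _)))

predecessor : ∀ {n} (k : Fin n) → Σ (Fin n) λ l → Consec n (toℕ l) (toℕ k)
predecessor {suc m} zero    = fromℕ m , inj₂ (cong suc (toℕ-fromℕ m) , refl)
predecessor         (suc j) = inject₁ j , inj₁ (cong suc (toℕ-inject₁ j))

injective⇒surjective : ∀ {n} {f : Fin n → Fin n} → Injective _≡_ _≡_ f → ∀ v → ∃ λ k → f k ≡ v
injective⇒surjective {suc m} {f} f-inj v with any? (λ k → f k ≟ v)
... | yes hit = hit
... | no  miss = ⊥-elim (ℕ.1+n≰n (injective⇒≤ {f = squeeze} squeeze-inj))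
  where
  missed : ∀ k → v ≢ f k
  missed k v≡fk = miss (k , sym v≡fk)
  squeeze : Fin (suc m) → Fin m
  squeeze k = punchOut (missed k)
  squeeze-inj : Injective _≡_ _≡_ squeeze
  squeeze-inj {k} {l} eq = f-inj (punchOut-injective (missed k) (missed l) eq)

CycleEdge-sym : ∀ {n} {f : Fin n → Fin n} {u v} → CycleEdge n f u v → CycleEdge n f v u
CycleEdge-sym (k , l , c , inj₁ (fk≡u , fl≡v)) = k , l , c , inj₂ (fk≡u , fl≡v)
CycleEdge-sym (k , l , c , inj₂ (fk≡v , fl≡u)) = k , l , c , inj₁ (fk≡v , fl≡u)

KnMinusCycle-sym : ∀ {n} {f : Fin n → Fin n} {u v} → KnMinusCycle n f u v → KnMinusCycle n f v u
KnMinusCycle-sym (u≢v , ¬uv) = u≢v ∘ sym , ¬uv ∘ CycleEdge-sym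

-- Cycles on at most six vertices

Chord : (n : ℕ) → Fin n → Fin n → Set
Chord n a b = a ≢ b × ¬ Boundary n a b

consec? : ∀ n x y → Dec (Consec n x y)
consec? n x y = (suc x ℕ.≟ y) ⊎-dec ((suc x ℕ.≟ n) ×-dec (y ℕ.≟ 0))

boundary? : ∀ n (u v : Fin n) → Dec (Boundary n u v)
boundary? n u v = consec? n (toℕ u) (toℕ v) ⊎-dec consec? n (toℕ v) (toℕ u)

chord? : ∀ n (a b : Fin n) → Dec (Chord n a b)
chord? n a b = ¬? (a ≟ b) ×-dec ¬? (boundary? n a b)

triangle-chordless : ∀ {a b} → ¬ Chord 3 a b
triangle-chordless {a} {b} = from-yes (all? λ a → all? λ b → ¬? (chord? 3 a b)) a b

quadrilateral-chord-unique : ∀ {a p q} → Chord 4 a p → Chord 4 a q → p ≡ q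
quadrilateral-chord-unique {a} {p} {q} = from-yes (all? λ a → all? λ p → all? λ q →
  chord? 4 a p →-dec (chord? 4 a q →-dec (p ≟ q))) a p q

pentagon-chords : ∀ {a p q b} → Chord 5 a p → Chord 5 a q → p ≢ q → Chord 5 a b → b ≡ p ⊎ b ≡ q
pentagon-chords {a} {p} {q} {b} = from-yes (all? λ a → all? λ p → all? λ q → all? λ b →
  chord? 5 a p →-dec (chord? 5 a q →-dec (¬? (p ≟ q) →-dec (chord? 5 a b →-dec ((b ≟ p) ⊎-dec (b ≟ q)))))) a p q b

hexagon-chords : ∀ {a p q b c} → Chord 6 a p → Chord 6 a q → p ≢ q →
                 Chord 6 a b → b ≢ p → b ≢ q → Chord 6 a c → c ≢ p → c ≢ q → b ≡ c
hexagon-chords {a} {p} {q} {b} {c} ap aq p≢q ab b≢p b≢q ac c≢p c≢q =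
  decided a p ap q aq p≢q b ab b≢p b≢q c ac c≢p c≢q
  where
  decided : ∀ a p → Chord 6 a p → ∀ q → Chord 6 a q → p ≢ q →
            ∀ b → Chord 6 a b → b ≢ p → b ≢ q → ∀ c → Chord 6 a c → c ≢ p → c ≢ q → b ≡ c
  decided = from-yes (all? λ a → all? λ p → chord? 6 a p →-dec all? λ q → chord? 6 a q →-dec (¬? (p ≟ q) →-dec
    all? λ b → chord? 6 a b →-dec (¬? (b ≟ p) →-dec (¬? (b ≟ q) →-dec
    all? λ c → chord? 6 a c →-dec (¬? (c ≟ p) →-dec (¬? (c ≟ q) →-dec (b ≟ c)))))))

Diagonal : (n : ℕ) → Fin n × Fin n → Set
Diagonal n (a , b) = toℕ a < toℕ b × ¬ Boundary n a b

TriangulationDiagonal : (n : ℕ) → (Fin n → Fin n → Set) → Fin n × Fin n → Set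
TriangulationDiagonal n G (a , b) = toℕ a < toℕ b × ¬ Boundary n a b × G a b

Disjoint : ∀ {n} → Fin n × Fin n → Fin n × Fin n → Set
Disjoint (a , b) (c , d) = a ≢ c × a ≢ d × b ≢ c × b ≢ d

Compatible : ∀ {n} → Fin n × Fin n → Fin n × Fin n → Set
Compatible d e = Disjoint d e × ¬ Cross d e

hexagon-diagonals-meet : ∀ {d₁ d₂ d₃} → Diagonal 6 d₁ → Diagonal 6 d₂ → Diagonal 6 d₃ →
                         Compatible d₁ d₂ → Compatible d₁ d₃ → Compatible d₂ d₃ → ⊥
hexagon-diagonals-meet {a , b} {c , d} {e , f} ab cd ef ab∥cd ab∥ef cd∥ef =
  decided a b ab c d cd ab∥cd e f ef ab∥ef cd∥ef
  where
  diagonal? : ∀ d → Dec (Diagonal 6 d)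
  diagonal? (a , b) = (toℕ a ℕ.<? toℕ b) ×-dec ¬? (boundary? 6 a b)
  cross? : (d e : Fin 6 × Fin 6) → Dec (Cross d e)
  cross? (a , b) (c , d) =
    ((toℕ a ℕ.<? toℕ c) ×-dec ((toℕ c ℕ.<? toℕ b) ×-dec (toℕ b ℕ.<? toℕ d))) ⊎-dec
    ((toℕ c ℕ.<? toℕ a) ×-dec ((toℕ a ℕ.<? toℕ d) ×-dec (toℕ d ℕ.<? toℕ b)))
  compatible? : (d e : Fin 6 × Fin 6) → Dec (Compatible d e)
  compatible? (a , b) (c , d) =
    (¬? (a ≟ c) ×-dec (¬? (a ≟ d) ×-dec (¬? (b ≟ c) ×-dec ¬? (b ≟ d)))) ×-dec ¬? (cross? (a , b) (c , d))
  decided : ∀ a b → Diagonal 6 (a , b) → ∀ c d → Diagonal 6 (c , d) → Compatible (a , b) (c , d) →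
            ∀ e f → Diagonal 6 (e , f) → Compatible (a , b) (e , f) → Compatible (c , d) (e , f) → ⊥
  decided = from-yes (all? λ a → all? λ b → diagonal? (a , b) →-dec all? λ c → all? λ d →
    diagonal? (c , d) →-dec (compatible? (a , b) (c , d) →-dec all? λ e → all? λ f →
    diagonal? (e , f) →-dec (compatible? (a , b) (e , f) →-dec (compatible? (c , d) (e , f) →-dec no λ ()))))

module Triangulated {n} {f : Fin n → Fin n} (f-inj : Injective _≡_ _≡_ f)
                    (tri : AdmitsTriangulation n (KnMinusCycle n f)) where

  cycleEdge⇒¬Boundary : ∀ {u v} → CycleEdge n f u v → ¬ Boundary n u v
  cycleEdge⇒¬Boundary uv b = proj₂ (proj₁ tri _ _ b) uv

  diagonal≢neighbour : ∀ {a p b} → CycleEdge n f a p → KnMinusCycle n f a b → b ≢ p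
  diagonal≢neighbour ap (_ , ¬ab) refl = ¬ab ap

  neighbours : 3 ≤ n → ∀ a → ∃₂ λ p q → p ≢ q × CycleEdge n f a p × CycleEdge n f a q × Chord n a p × Chord n a q
  neighbours 3≤n a with k , refl ← injective⇒surjective f-inj a =
    f l , f l′ , l≢l′ ∘ f-inj , kl-edge , l′k-edge ,
    (k≢l ∘ f-inj , cycleEdge⇒¬Boundary kl-edge) , (k≢l′ ∘ f-inj , cycleEdge⇒¬Boundary l′k-edge)
    where
    l  = proj₁ (successor k)
    l′ = proj₁ (predecessor k)
    kl  = proj₂ (successor k)
    l′k = proj₂ (predecessor k)
    kl-edge : CycleEdge n f (f k) (f l)
    kl-edge = k , l , kl , inj₁ (refl , refl)
    l′k-edge : CycleEdge n f (f k) (f l′)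
    l′k-edge = l′ , k , l′k , inj₂ (refl , refl)
    consec⇒≢ : ∀ {i j} → Consec n (toℕ i) (toℕ j) → i ≢ j
    consec⇒≢ c refl with refl ← Consec-irrefl c = ℕ.<⇒≱ 3≤n (s≤s z≤n)
    k≢l : k ≢ l
    k≢l = consec⇒≢ kl
    k≢l′ : k ≢ l′
    k≢l′ = consec⇒≢ l′k ∘ sym
    l≢l′ : l ≢ l′
    l≢l′ l≡l′ = ℕ.<⇒≱ 3≤n (Consec-asym kl (subst (λ i → Consec n (toℕ i) (toℕ k)) (sym l≡l′) l′k))

not-triangulable₃ : ¬ CyclePotentiallyTriangulable 3
not-triangulable₃ (_ , f-inj , tri)
  with _ , _ , _ , _ , _ , ap , _ ← Triangulated.neighbours f-inj tri ℕ.≤-refl 0F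
  = triangle-chordless ap

not-triangulable₄ : ¬ CyclePotentiallyTriangulable 4
not-triangulable₄ (_ , f-inj , tri)
  with _ , _ , p≢q , _ , _ , ap , aq ← Triangulated.neighbours f-inj tri (ℕ.m≤m+n 3 _) 0F
  = p≢q (quadrilateral-chord-unique ap aq)

not-triangulable₅ : ¬ CyclePotentiallyTriangulable 5
not-triangulable₅ (_ , _ , _ , [] , () , _)
not-triangulable₅ (_ , f-inj , tri@(_ , (a , b) ∷ _ , _ , _ , (_ , ¬ab , G-ab) ∷ _ , _))
  with _ , _ , p≢q , ap-edge , aq-edge , ap , aq ← Triangulated.neighbours f-inj tri (ℕ.m≤m+n 3 _) a
  = [ diagonal≢neighbour ap-edge G-ab , diagonal≢neighbour aq-edge G-ab ]′
      (pentagon-chords ap aq p≢q (proj₁ G-ab , ¬ab))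
  where open Triangulated f-inj tri using (diagonal≢neighbour)

module Hexagon {f : Fin 6 → Fin 6} (f-inj : Injective _≡_ _≡_ f)
               (tri : AdmitsTriangulation 6 (KnMinusCycle 6 f)) where
  open Triangulated f-inj tri

  Used : Fin 6 × Fin 6 → Set
  Used = TriangulationDiagonal 6 (KnMinusCycle 6 f)

  diagonal-unique : ∀ {a b c} → ¬ Boundary 6 a b → KnMinusCycle 6 f a b →
                    ¬ Boundary 6 a c → KnMinusCycle 6 f a c → b ≡ c
  diagonal-unique {a} ¬ab G-ab ¬ac G-ac
    with _ , _ , p≢q , ap-edge , aq-edge , ap , aq ← neighbours (ℕ.m≤m+n 3 _) a
    = hexagon-chords ap aq p≢q
        (proj₁ G-ab , ¬ab) (diagonal≢neighbour ap-edge G-ab) (diagonal≢neighbour aq-edge G-ab)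
        (proj₁ G-ac , ¬ac) (diagonal≢neighbour ap-edge G-ac) (diagonal≢neighbour aq-edge G-ac)

  distinct-diagonals-disjoint : ∀ {d e} → Used d → Used e → d ≢ e → Disjoint d e
  distinct-diagonals-disjoint {a , b} {c , d} (a<b , ¬ab , G-ab) (c<d , ¬cd , G-cd) ab≢cd =
      (λ { refl → ab≢cd (cong (a ,_) (diagonal-unique ¬ab G-ab ¬cd G-cd)) })
    , (λ { refl → ℕ.<-asym a<b (subst (λ x → toℕ x < toℕ a)
                    (sym (diagonal-unique ¬ab G-ab (¬cd ∘ Boundary-sym) (KnMinusCycle-sym G-cd))) c<d) })
    , (λ { refl → ℕ.<-asym a<b (subst (λ x → toℕ b < toℕ x)
                    (sym (diagonal-unique (¬ab ∘ Boundary-sym) (KnMinusCycle-sym G-ab) ¬cd G-cd)) c<d) })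
    , (λ { refl → ab≢cd (cong (_, b) (diagonal-unique (¬ab ∘ Boundary-sym) (KnMinusCycle-sym G-ab)
                                                      (¬cd ∘ Boundary-sym) (KnMinusCycle-sym G-cd))) })

  compatible : ∀ {d e} → Used d → Used e → d ≢ e → ¬ Cross d e → Compatible d e
  compatible h h′ d≢e nc = distinct-diagonals-disjoint h h′ d≢e , nc

not-triangulable₆ : ¬ CyclePotentiallyTriangulable 6
not-triangulable₆ (_ , _ , _ , [] , () , _)
not-triangulable₆ (_ , _ , _ , _ ∷ [] , () , _)
not-triangulable₆ (_ , _ , _ , _ ∷ _ ∷ [] , () , _)
not-triangulable₆ (_ , _ , _ , _ ∷ _ ∷ _ ∷ _ ∷ _ , () , _)
not-triangulable₆ (_ , f-inj , tri@(_ , _ ∷ _ ∷ _ ∷ [] , _ , (≢₁₂ ∷ ≢₁₃ ∷ []) ∷ (≢₂₃ ∷ []) ∷ [] ∷ [] ,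
                             h₁ ∷ h₂ ∷ h₃ ∷ [] , (nc₁₂ ∷ nc₁₃ ∷ []) ∷ (nc₂₃ ∷ []) ∷ [] ∷ []))
  = hexagon-diagonals-meet (diagonal h₁) (diagonal h₂) (diagonal h₃)
      (compatible h₁ h₂ ≢₁₂ nc₁₂) (compatible h₁ h₃ ≢₁₃ nc₁₃) (compatible h₂ h₃ ≢₂₃ nc₂₃)
  where
  open Hexagon f-inj tri
  diagonal : ∀ {d} → Used d → Diagonal 6 d
  diagonal (a<b , ¬ab , _) = a<b , ¬ab

-- A cycle and a triangulation of its complement for n ≥ 7

data Zigzag : ℕ → ℕ → Set where
  skip   : ∀ {x} → x ≢ 1 → Zigzag x (2 + x)
  bridge : Zigzag 0 3
  apex   : ∀ {y} → 5 ≤ y → Zigzag 1 y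

Zigzag⇒¬Consec : ∀ {m x y} → Zigzag x y → ¬ Consec (5 + m) x y
Zigzag⇒¬Consec (skip _)                   (inj₁ 1+x≡2+x) = ℕ.1+n≢n (sym 1+x≡2+x)
Zigzag⇒¬Consec (skip _)                   (inj₂ (_ , ()))
Zigzag⇒¬Consec bridge                     (inj₁ ())
Zigzag⇒¬Consec bridge                     (inj₂ (_ , ()))
Zigzag⇒¬Consec (apex (s≤s (s≤s (s≤s _)))) (inj₁ ())
Zigzag⇒¬Consec (apex _)                   (inj₂ (() , _))

Zigzag⇒¬Consecʳ : ∀ {m x y} → Zigzag x y → ¬ Consec (5 + m) y x
Zigzag⇒¬Consecʳ (skip _)       (inj₁ 3+x≡x) = ℕ.m≢1+n+m _ {2} (sym 3+x≡x)
Zigzag⇒¬Consecʳ (skip _)       (inj₂ (() , refl))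
Zigzag⇒¬Consecʳ bridge         (inj₁ ())
Zigzag⇒¬Consecʳ bridge         (inj₂ (() , _))
Zigzag⇒¬Consecʳ (apex (s≤s _)) (inj₁ ())
Zigzag⇒¬Consecʳ (apex _)       (inj₂ (_ , ()))

Zigzag⇒¬Boundary : ∀ {m} {u v : Fin (5 + m)} → SymClosure Zigzag (toℕ u) (toℕ v) → ¬ Boundary (5 + m) u v
Zigzag⇒¬Boundary (fwd uv) = [ Zigzag⇒¬Consec uv , Zigzag⇒¬Consecʳ uv ]′
Zigzag⇒¬Boundary (bwd vu) = [ Zigzag⇒¬Consecʳ vu , Zigzag⇒¬Consec vu ]′

¬Zigzag-0 : ∀ {y} → 4 ≤ y → ¬ SymClosure Zigzag 0 y
¬Zigzag-0 4≤y (fwd (skip _)) = ℕ.<⇒≱ 4≤y (s≤s (s≤s z≤n))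
¬Zigzag-0 4≤y (fwd bridge)   = ℕ.<⇒≱ 4≤y ℕ.≤-refl
¬Zigzag-0 _   (bwd (apex ()))

¬Zigzag-1 : ∀ {y} → y ≤ 4 → ¬ SymClosure Zigzag 1 y
¬Zigzag-1 _   (fwd (skip 1≢1)) = 1≢1 refl
¬Zigzag-1 y≤4 (fwd (apex 5≤y)) = ℕ.<⇒≱ 5≤y y≤4
¬Zigzag-1 _   (bwd (apex (s≤s ())))

gap⇒¬Consec : ∀ {n x y} → 2 + x ≤ y → ¬ Consec n x y
gap⇒¬Consec 2+x≤y (inj₁ refl)      = ℕ.1+n≰n 2+x≤y
gap⇒¬Consec ()    (inj₂ (_ , refl))

gap⇒¬Consecʳ : ∀ {n x y} → x < y → 2 + y ≤ x + n → ¬ Consec n y x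
gap⇒¬Consecʳ x<y _      (inj₁ refl)         = ℕ.<-asym x<y (ℕ.n<1+n _)
gap⇒¬Consecʳ _   2+y≤n  (inj₂ (refl , refl)) = ℕ.1+n≰n 2+y≤n

gap⇒¬Boundary : ∀ {n} {a b : Fin n} → 2 + toℕ a ≤ toℕ b → 2 + toℕ b ≤ toℕ a + n → ¬ Boundary n a b
gap⇒¬Boundary 2+a≤b 2+b≤a+n = [ gap⇒¬Consec 2+a≤b , gap⇒¬Consecʳ (ℕ.≤-trans (ℕ.n≤1+n _) 2+a≤b) 2+b≤a+n ]′

¬Cross-shared : ∀ {n} {a b d : Fin n} → ¬ Cross (a , b) (a , d)
¬Cross-shared (inj₁ (a<a , _)) = ℕ.<-irrefl refl a<a
¬Cross-shared (inj₂ (a<a , _)) = ℕ.<-irrefl refl a<a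

¬Cross-nested : ∀ {n} {a b c d : Fin n} → toℕ a < toℕ c → toℕ d ≤ toℕ b → ¬ Cross (c , d) (a , b)
¬Cross-nested a<c _   (inj₁ (c<a , _))      = ℕ.<-asym a<c c<a
¬Cross-nested _   d≤b (inj₂ (_ , _ , b<d)) = ℕ.<⇒≱ b<d d≤b

fanTip : ∀ {k} → Fin (2 + k) → Fin (7 + k)
fanTip i = 4 ↑ʳ inject₁ i

toℕ-fanTip : ∀ {k} (i : Fin (2 + k)) → toℕ (fanTip i) ≡ 4 + toℕ i
toℕ-fanTip i = trans (toℕ-↑ʳ 4 (inject₁ i)) (cong (4 +_) (toℕ-inject₁ i))

fanTip-injective : ∀ {k} → Injective _≡_ _≡_ (fanTip {k})
fanTip-injective eq = inject₁-injective (↑ʳ-injective 4 _ _ eq)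

4≤fanTip : ∀ {k} (i : Fin (2 + k)) → 4 ≤ toℕ (fanTip i)
4≤fanTip i = subst (4 ≤_) (sym (toℕ-fanTip i)) (ℕ.m≤m+n 4 _)

2+fanTip≤n : ∀ {k} (i : Fin (2 + k)) → 2 + toℕ (fanTip i) ≤ 7 + k
2+fanTip≤n {k} i = subst (λ t → 2 + t ≤ 7 + k) (sym (toℕ-fanTip i)) (ℕ.+-monoʳ-≤ 6 (ℕ.≤-pred (toℕ<n i)))

fan : ∀ {k} → Fin (2 + k) → Fin (7 + k) × Fin (7 + k)
fan i = 0F , fanTip i

diagonals : ∀ k → List (Fin (7 + k) × Fin (7 + k))
diagonals k = (1F , 3F) ∷ (1F , 4F) ∷ tabulate fan

module ZigzagTriangulation {k} {f : Fin (7 + k) → Fin (7 + k)}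
         (zigzag-edge : ∀ {u v} → CycleEdge (7 + k) f u v → SymClosure Zigzag (toℕ u) (toℕ v)) where

  boundary-kept : ∀ u v → Boundary (7 + k) u v → KnMinusCycle (7 + k) f u v
  boundary-kept u v uv = (λ { refl → Boundary-irrefl (s≤s (s≤s z≤n)) uv }) ,
                         λ e → Zigzag⇒¬Boundary (zigzag-edge e) uv

  diagonal-kept : ∀ {a b} → 2 + toℕ a ≤ toℕ b → 2 + toℕ b ≤ toℕ a + (7 + k) →
                  ¬ SymClosure Zigzag (toℕ a) (toℕ b) →
         TriangulationDiagonal (7 + k) (KnMinusCycle (7 + k) f) (a , b)
  diagonal-kept 2+a≤b 2+b≤a+n ¬ab =
    a<b , gap⇒¬Boundary 2+a≤b 2+b≤a+n , (λ { refl → ℕ.<-irrefl refl a<b }) , ¬ab ∘ zigzag-edge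
    where a<b = ℕ.≤-trans (ℕ.n≤1+n _) 2+a≤b

  triangulation : AdmitsTriangulation (7 + k) (KnMinusCycle (7 + k) f)
  triangulation =
    boundary-kept , diagonals k , cong (2 +_) (length-tabulate fan) , distinct , all-kept , non-crossing
    where
    distinct : Unique (diagonals k)
    distinct = ((λ ()) ∷ Allₚ.tabulate⁺ {f = fan} (λ _ ())) ∷ Allₚ.tabulate⁺ {f = fan} (λ _ ())
             ∷ AllPairsₚ.tabulate⁺ {f = fan} (λ i≢j → i≢j ∘ fanTip-injective ∘ cong proj₂)
    all-kept : All (TriangulationDiagonal (7 + k) (KnMinusCycle (7 + k) f)) (diagonals k)
    all-kept = diagonal-kept ℕ.≤-refl (s≤s (s≤s (s≤s (s≤s (s≤s z≤n))))) (¬Zigzag-1 (s≤s (s≤s (s≤s z≤n))))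
             ∷ diagonal-kept (s≤s (s≤s (s≤s z≤n))) (s≤s (s≤s (s≤s (s≤s (s≤s (s≤s z≤n)))))) (¬Zigzag-1 ℕ.≤-refl)
             ∷ Allₚ.tabulate⁺ {f = fan} (λ i →
                 diagonal-kept (ℕ.≤-trans (s≤s (s≤s z≤n)) (4≤fanTip i)) (2+fanTip≤n i) (¬Zigzag-0 (4≤fanTip i)))
    non-crossing : AllPairs (λ d e → ¬ Cross d e) (diagonals k)
    non-crossing = (¬Cross-shared {n = 7 + k} {1F} {3F} {4F}
                     ∷ Allₚ.tabulate⁺ {f = fan} (λ i → ¬Cross-nested (s≤s z≤n) (ℕ.≤-trans (ℕ.n≤1+n 3) (4≤fanTip i))))
                 ∷ Allₚ.tabulate⁺ {f = fan} (λ i → ¬Cross-nested (s≤s z≤n) (4≤fanTip i))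
                 ∷ AllPairsₚ.tabulate⁺ {f = fan} (λ _ → ¬Cross-shared)

lookup-injective : ∀ {A : Set} {xs : List A} → Unique xs → ∀ {i j} → lookup xs i ≡ lookup xs j → i ≡ j
lookup-injective {xs = _ ∷ _} _        {zero}  {zero}  _  = refl
lookup-injective {xs = _ ∷ _} (x∉ ∷ _) {zero}  {suc j} eq = contradiction eq (All.lookup x∉ (∈-lookup j))
lookup-injective {xs = _ ∷ _} (x∉ ∷ _) {suc i} {zero}  eq = contradiction (sym eq) (All.lookup x∉ (∈-lookup i))
lookup-injective {xs = _ ∷ _} (_ ∷ u)  {suc i} {suc j} eq = cong suc (lookup-injective u eq)

Linked-lookup : ∀ {A : Set} {R : A → A → Set} {xs} → Linked R xs →
                ∀ {i j : Fin (length xs)} → suc (toℕ i) ≡ toℕ j → R (lookup xs i) (lookup xs j)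
Linked-lookup [-]      {zero}  {zero}        ()
Linked-lookup (r ∷ _)  {zero}  {suc zero}    refl = r
Linked-lookup (_ ∷ _)  {zero}  {suc (suc _)} ()
Linked-lookup (_ ∷ _)  {suc _} {zero}        ()
Linked-lookup (_ ∷ rs) {suc _} {suc _}       eq   = Linked-lookup rs (ℕ.suc-injective eq)

last-lookup : ∀ {A : Set} {xs : List A} {i : Fin (length xs)} →
              suc (toℕ i) ≡ length xs → last xs ≡ just (lookup xs i)
last-lookup {xs = _ ∷ []}    {zero}  _  = refl
last-lookup {xs = _ ∷ _ ∷ _} {zero}  ()
last-lookup {xs = _ ∷ _ ∷ _} {suc _} eq = last-lookup (ℕ.suc-injective eq)

Consec-lookup : ∀ {A : Set} {R : A → A → Set} {xs} → Linked R xs → Connected R (last xs) (head xs) →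
                ∀ {i j : Fin (length xs)} → Consec (length xs) (toℕ i) (toℕ j) → R (lookup xs i) (lookup xs j)
Consec-lookup linked _ (inj₁ 1+i≡j) = Linked-lookup linked 1+i≡j
Consec-lookup {R = R} {xs = _ ∷ _} _ closed {j = zero} (inj₂ (1+i≡n , _)) =
  Connected.drop-just (subst (λ m → Connected R m _) (last-lookup 1+i≡n) closed)
Consec-lookup {xs = _ ∷ _} _ _ {j = suc _} (inj₂ (_ , ()))

Placement : (ℕ → ℕ → Set) → ℕ → Set
Placement R n = Σ (Fin n → Fin n) λ f → Injective _≡_ _≡_ f × (∀ {u v} → CycleEdge n f u v → R (toℕ u) (toℕ v))

placement-along : ∀ {R : ℕ → ℕ → Set} → Symmetric R → (xs : List ℕ) →
                  All (_< length xs) xs → Unique xs → Linked R xs → Connected R (last xs) (head xs) →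
                  Placement R (length xs)
placement-along {R} R-sym xs bounded distinct linked closed = place , place-injective , place-edge
  where
  place : Fin (length xs) → Fin (length xs)
  place i = fromℕ< (All.lookup bounded (∈-lookup i))
  toℕ-place : ∀ i → toℕ (place i) ≡ lookup xs i
  toℕ-place i = toℕ-fromℕ< _
  place-injective : Injective _≡_ _≡_ place
  place-injective {i} {j} eq =
    lookup-injective distinct (trans (sym (toℕ-place i)) (trans (cong toℕ eq) (toℕ-place j)))
  place-step : ∀ {i j} → Consec (length xs) (toℕ i) (toℕ j) → R (toℕ (place i)) (toℕ (place j))
  place-step {i} {j} ij = subst₂ R (sym (toℕ-place i)) (sym (toℕ-place j)) (Consec-lookup linked closed ij)
  place-edge : ∀ {u v} → CycleEdge (length xs) place u v → R (toℕ u) (toℕ v)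
  place-edge (_ , _ , ij , inj₁ (refl , refl)) = place-step ij
  place-edge (_ , _ , ij , inj₂ (refl , refl)) = R-sym (place-step ij)

last-++ : ∀ {A : Set} (xs : List A) {y ys} → last (xs ++ y ∷ ys) ≡ last (y ∷ ys)
last-++ []           = refl
last-++ (_ ∷ [])     = refl
last-++ (_ ∷ x ∷ xs) = last-++ (x ∷ xs)

last-applyUpTo : ∀ {A : Set} (f : ℕ → A) m → last (applyUpTo f (suc m)) ≡ just (f m)
last-applyUpTo f m = trans (cong last (sym (applyUpTo-∷ʳ f m))) (last-++ (applyUpTo f m))

last-applyDownFrom : ∀ {A : Set} (f : ℕ → A) m → last (applyDownFrom f (suc m)) ≡ just (f 0)
last-applyDownFrom f m = trans (cong last (sym (applyDownFrom-∷ʳ f m))) (last-++ (applyDownFrom (f ∘ suc) m))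

evens : ℕ → List ℕ
evens e = applyUpTo (2 *_) e

odds : ℕ → List ℕ
odds o = applyDownFrom (λ i → 3 + 2 * i) o

tour : ℕ → ℕ → List ℕ
tour e o = 1 ∷ odds o ++ evens e

length-tour : ∀ e o → length (tour e o) ≡ suc (o + e)
length-tour e o =
  cong suc (trans (length-++ (odds o)) (cong₂ _+_ (length-applyDownFrom _ o) (length-applyUpTo _ e)))

evens-step : ∀ i → Zigzag (2 * i) (2 * suc i)
evens-step i = subst (Zigzag (2 * i)) (sym (ℕ.*-suc 2 i)) (skip (ℕ.even≢odd i 0))

odds-step : ∀ i → Zigzag (3 + 2 * i) (3 + 2 * suc i)
odds-step i = subst (Zigzag (3 + 2 * i)) (cong (3 +_) (sym (ℕ.*-suc 2 i))) (skip λ ())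

tour-linked : ∀ {e o} → 2 ≤ o → 1 ≤ e → Linked (SymClosure Zigzag) (tour e o)
tour-linked {suc e} {suc o} (s≤s 1≤o) _ =
  fwd (apex (ℕ.+-monoʳ-≤ 3 (ℕ.*-monoʳ-≤ 2 1≤o)))
  ∷ Linkedₚ.++⁺ (Linkedₚ.applyDownFrom⁺₂ _ (suc o) (bwd ∘ odds-step)) odds-evens
                (Linkedₚ.applyUpTo⁺₂ _ (suc e) (fwd ∘ evens-step))
  where
  odds-evens : Connected (SymClosure Zigzag) (last (odds (suc o))) (head (evens (suc e)))
  odds-evens = subst (λ m → Connected _ m _) (sym (last-applyDownFrom _ o)) (just (bwd bridge))

tour-closed : ∀ {e o} → 1 ≤ o → 4 ≤ e → Connected (SymClosure Zigzag) (last (tour e o)) (head (tour e o))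
tour-closed {suc e} {suc o} _ (s≤s 3≤e) =
  subst (λ m → Connected _ m _) (sym (trans (last-++ (odds (suc o))) (last-applyUpTo (2 *_) e)))
    (just (bwd (apex (ℕ.≤-trans (ℕ.n≤1+n 5) (ℕ.*-monoʳ-≤ 2 3≤e)))))

tour-distinct : ∀ e o → Unique (tour e o)
tour-distinct e o =
  Allₚ.++⁺ (Allₚ.applyDownFrom⁺₂ _ o (λ _ ())) (Allₚ.applyUpTo⁺₂ _ e (λ i → ℕ.even≢odd i 0 ∘ sym))
  ∷ Uniqueₚ.++⁺ odds-distinct evens-distinct parity
  where
  odds-distinct : Unique (odds o)
  odds-distinct = Uniqueₚ.applyDownFrom⁺₁ _ o λ j<i _ eq →
    ℕ.<-irrefl (sym (ℕ.*-cancelˡ-≡ _ _ 2 (ℕ.+-cancelˡ-≡ 3 _ _ eq))) j<i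
  evens-distinct : Unique (evens e)
  evens-distinct = Uniqueₚ.applyUpTo⁺₁ _ e λ i<j _ eq → ℕ.<-irrefl (ℕ.*-cancelˡ-≡ _ _ 2 eq) i<j
  odds-odd : All (λ y → ∀ i → y ≢ 2 * i) (odds o)
  odds-odd = Allₚ.applyDownFrom⁺₂ _ o λ j i eq →
    ℕ.even≢odd i (suc j) (trans (sym eq) (cong suc (sym (ℕ.*-suc 2 j))))
  parity : ∀ {v} → ¬ (v ∈ odds o × v ∈ evens e)
  parity (v∈odds , v∈evens) with i , _ , refl ← ∈-applyUpTo⁻ (2 *_) v∈evens = All.lookup odds-odd v∈odds i refl

1+i+1+i≡2+2i : ∀ i → suc i + suc i ≡ 2 + 2 * i
1+i+1+i≡2+2i = solve-∀

1+i+2+i≡3+2i : ∀ i → suc i + suc (suc i) ≡ 3 + 2 * i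
1+i+2+i≡3+2i = solve-∀

tour-bounded : ∀ {e o} → o < e → e ≤ 2 + o → All (_< suc (o + e)) (tour e o)
tour-bounded {e} {o} o<e e≤2+o =
  s≤s (ℕ.≤-trans (s≤s z≤n) (ℕ.≤-trans o<e (ℕ.m≤n+m e o)))
  ∷ Allₚ.++⁺ (Allₚ.applyDownFrom⁺₁ _ o (s≤s ∘ odd-bound)) (Allₚ.applyUpTo⁺₁ _ e (s≤s ∘ even-bound))
  where
  odd-bound : ∀ {i} → i < o → 3 + 2 * i ≤ o + e
  odd-bound {i} i<o = subst (_≤ o + e) (1+i+2+i≡3+2i i) (ℕ.+-mono-≤ i<o (ℕ.≤-trans (s≤s i<o) o<e))
  even-bound : ∀ {i} → i < e → 2 * i ≤ o + e
  even-bound {i} i<e =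
    ℕ.+-cancelˡ-≤ 2 _ _ (subst (_≤ 2 + (o + e)) (1+i+1+i≡2+2i i) (ℕ.+-mono-≤ (ℕ.≤-trans i<e e≤2+o) i<e))

tour-placement : ∀ {e o} → 2 ≤ o → 4 ≤ e → o < e → e ≤ 2 + o → Placement (SymClosure Zigzag) (suc (o + e))
tour-placement {e} {o} 2≤o 4≤e o<e e≤2+o =
  subst (Placement (SymClosure Zigzag)) (length-tour e o)
    (placement-along (SymClosure.symmetric Zigzag) (tour e o)
      (subst (λ n → All (_< n) (tour e o)) (sym (length-tour e o)) (tour-bounded o<e e≤2+o))
      (tour-distinct e o)
      (tour-linked 2≤o (ℕ.≤-trans (s≤s z≤n) 4≤e))
      (tour-closed (ℕ.≤-trans (s≤s z≤n) 2≤o) 4≤e))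

triangulable-of-placement : ∀ {k} → Placement (SymClosure Zigzag) (7 + k) → CyclePotentiallyTriangulable (7 + k)
triangulable-of-placement (f , f-inj , zigzag-edge) = f , f-inj , ZigzagTriangulation.triangulation zigzag-edge

-- For n = 7 + k the tour uses e = ⌈n/2⌉ even vertices and o = ⌊n/2⌋ − 1 odd ones besides 1.
triangulable-from-7 : ∀ k → CyclePotentiallyTriangulable (7 + k)
triangulable-from-7 k = triangulable-of-placement (subst (Placement (SymClosure Zigzag)) size
  (tour-placement {4 + ⌊ k /2⌋} {2 + ⌈ k /2⌉} (ℕ.m≤m+n 2 _) (ℕ.m≤m+n 4 _)
    (ℕ.+-monoʳ-≤ 3 (ℕ.⌊n/2⌋-mono (ℕ.n≤1+n (suc k)))) (ℕ.+-monoʳ-≤ 4 (ℕ.⌊n/2⌋≤⌈n/2⌉ k))))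
  where
  size : 3 + (⌈ k /2⌉ + (4 + ⌊ k /2⌋)) ≡ 7 + k
  size = cong (3 +_) (trans (ℕ.+-comm ⌈ k /2⌉ (4 + ⌊ k /2⌋)) (cong (4 +_) (ℕ.⌊n/2⌋+⌈n/2⌉≡n k)))

not-triangulable-below-7 : ∀ {n} → 3 ≤ n → n < 7 → ¬ CyclePotentiallyTriangulable n
not-triangulable-below-7 {1} (s≤s ()) _
not-triangulable-below-7 {2} (s≤s (s≤s ())) _
not-triangulable-below-7 {3} _ _ = not-triangulable₃
not-triangulable-below-7 {4} _ _ = not-triangulable₄
not-triangulable-below-7 {5} _ _ = not-triangulable₅
not-triangulable-below-7 {6} _ _ = not-triangulable₆
not-triangulable-below-7 {suc (suc (suc (suc (suc (suc (suc _))))))} _ (s≤s (s≤s (s≤s (s≤s (s≤s (s≤s (s≤s ())))))))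

theorem4 : (n : ℕ) → 3 ≤ n →
    (CyclePotentiallyTriangulable n → 7 ≤ n) × (7 ≤ n → CyclePotentiallyTriangulable n)
theorem4 n 3≤n = only-if , if
  where
  only-if : CyclePotentiallyTriangulable n → 7 ≤ n
  only-if triangulable with 7 ℕ.≤? n
  ... | yes 7≤n = 7≤n
  ... | no  7≰n = contradiction triangulable (not-triangulable-below-7 3≤n (ℕ.≰⇒> 7≰n))
  if : 7 ≤ n → CyclePotentiallyTriangulable n
  if 7≤n = subst CyclePotentiallyTriangulable (ℕ.m+[n∸m]≡n 7≤n) (triangulable-from-7 (n ∸ 7))
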